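{- Let $G$ and $H$ be vertex-disjoint connected graphs, let $u_1,\dots,u_k$ be pairwise distinct vertices of $G$ and $v_1,\dots,v_k$ pairwise distinct vertices of $H$, and suppose that $G_S$ and $H_S$ are $T$-equivalent for every subset $S$ of $\{\{i,j\}:1\le i<j\le k\}$. Then $G$ and $H$ have the same number of loops, and for each pair $i,j$ with $1\le i<j\le k$, the number of edges of $G$ joining $u_i$ and $u_j$ equals the number of edges of $H$ joining $v_i$ and $v_j$.
   Context: Graphs may have loops and parallel edges. The Tutte polynomial of $G=(V,E)$ is $T_G(x,y)=\sum_{A\subseteq E}(x-1)^{r(E)-r(A)}(y-1)^{|A|-r(A)}$ with $r(A)=|V|-c(A)$, $c(A)$ the number of components of $(V,A)$; two graphs are $T$-equivalent if they have the same Tutte polynomial. For $S\subseteq\{\{i,j\}:1\le i<j\le k\}$, $G_S$ is obtained from $G$ by adding, for each $\{i,j\}\in S$, one new edge joining $u_i$ and $u_j$; $H_S$ is defined analogously using $v_i,v_j$. -}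

module Defs where

open import Data.Nat as ℕ using (ℕ; zero; suc; _∸_)
open import Data.Nat.Combinatorics using (_C_)
open import Data.Integer as ℤ using (ℤ)
open import Data.Bool using (Bool; true; false; _∧_; _∨_; not; if_then_else_)
open import Data.Fin as Fin using (Fin; toℕ)
open import Data.Fin.Properties using () renaming (_≟_ to _≟F_)
open import Data.List using (List; []; _∷_; _++_; length; map; concatMap; foldr)
open import Data.Bool.ListAction using (any; all)

count : ∀ {X : Set} → (X → Bool) → List X → ℕ
count p []       = 0
count p (x ∷ xs) = if p x then suc (count p xs) else count p xs
open import Data.List.Base using (allFin)
open import Data.Product using (_×_; _,_)
open import Relation.Nullary.Decidable using (⌊_⌋)
open import Relation.Binary.PropositionalEquality using (_≡_)

-- A finite multigraph (loops and parallel edges allowed) on vertex set Fin n.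
-- Each edge is an (unordered) pair of endpoints, stored as an ordered pair;
-- the list position distinguishes parallel edges.
record Graph : Set where
  field
    n     : ℕ
    edges : List (Fin n × Fin n)
open Graph public

_==_ : ∀ {n} → Fin n → Fin n → Bool
a == b = ⌊ a ≟F b ⌋

subsets : ∀ {X : Set} → List X → List (List X)
subsets []       = [] ∷ []
subsets (x ∷ xs) = let r = subsets xs in r ++ map (x ∷_) r

step : ∀ {n} → List (Fin n × Fin n) → (Fin n → Bool) → Fin n → Bool
step A R w = R w ∨ any (λ e → let (a , b) = e in (R a ∧ (b == w)) ∨ (R b ∧ (a == w))) A

iter : ℕ → {X : Set} → (X → X) → X → X
iter zero    f x = x
iter (suc t) f x = f (iter t f x)

-- reachable A v w : w is in the connected component of v in (Fin n, A)
-- (n iterations of the closure suffice)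
reachable : ∀ {n} → List (Fin n × Fin n) → Fin n → Fin n → Bool
reachable {n} A v = iter n (step A) (λ w → v == w)

-- c(A): number of connected components of (Fin n, A), counted by
-- their least vertex
components : ∀ {n} → List (Fin n × Fin n) → ℕ
components {n} A =
  count (λ v → all (λ w → not (⌊ toℕ w ℕ.<? toℕ v ⌋ ∧ reachable A v w)) (allFin n)) (allFin n)

rank : ∀ {n} → List (Fin n × Fin n) → ℕ
rank {n} A = n ∸ components A

-- coefficient of x^a in (x - 1)^p
binomCoeff : ℕ → ℕ → ℤ
binomCoeff p a = (ℤ.- ℤ.1ℤ) ℤ.^ (p ∸ a) ℤ.* ℤ.+ (p C a)

-- coefficient of x^a y^b in the Tutte polynomial
-- T_G(x,y) = Σ_{A ⊆ E} (x-1)^{r(E)-r(A)} (y-1)^{|A|-r(A)}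
tutteCoeff : Graph → ℕ → ℕ → ℤ
tutteCoeff G a b =
  foldr ℤ._+_ ℤ.0ℤ
    (map (λ A → binomCoeff (rank (edges G) ∸ rank A) a ℤ.* binomCoeff (length A ∸ rank A) b)
         (subsets (edges G)))

TEquivalent : Graph → Graph → Set
TEquivalent G H = ∀ a b → tutteCoeff G a b ≡ tutteCoeff H a b

Connected : Graph → Set
Connected G = components (edges G) ≡ 1

isLoop : ∀ {n} → Fin n × Fin n → Bool
isLoop (a , b) = a == b

numLoops : Graph → ℕ
numLoops G = count isLoop (edges G)

joins : ∀ {n} → Fin n → Fin n → Fin n × Fin n → Bool
joins x y (a , b) = ((a == x) ∧ (b == y)) ∨ ((a == y) ∧ (b == x))

numJoining : (G : Graph) → Fin (n G) → Fin (n G) → ℕ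
numJoining G x y = count (joins x y) (edges G)

-- A subset S of {{i,j} : i < j} of Fin k, given by its indicator on pairs
-- (only entries with i < j are used).
PairSet : ℕ → Set
PairSet k = Fin k → Fin k → Bool

addEdges : (G : Graph) {k : ℕ} → (Fin k → Fin (n G)) → PairSet k → Graph
addEdges G {k} u S = record
  { n = n G
  ; edges = edges G ++
      concatMap (λ i → concatMap (λ j →
         if ⌊ toℕ i ℕ.<? toℕ j ⌋ ∧ S i j then (u i , u j) ∷ [] else []) (allFin k)) (allFin k) }

-- The Tutte polynomial determines the rank generating polynomial R(x, y) = T(x + 1, y + 1), i.e. for
-- all P, Q the number of edge sets A with corank r(E) − r(A) = P and nullity |A| − r(A) = Q. In a
-- connected graph no edge set has rank above r(E), so the loops are the single edges of corank r(E)
-- and nullity 1, and the pairs of edges of rank at most 1 are counted by the coefficients (r(E), 2)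
-- and (r(E) − 1, 1). Adding the edge u_i u_j creates one new such pair for each loop and each edge
-- parallel to u_i u_j, so comparing G with G_{{i,j}} recovers the number of edges joining u_i and u_j.
module Submission where

open import Defs

module BinomialInversion where
  open import Data.Nat as ℕ using (ℕ; zero; suc; _∸_; _≡ᵇ_; _<_; s≤s)
  import Data.Nat.Properties as ℕₚ
  open import Data.Nat.Combinatorics using (_C_; nCk+nC[k+1]≡[n+1]C[k+1]; k>n⇒nCk≡0)
  open import Data.Integer using (ℤ; +_; 0ℤ; 1ℤ; -_; _+_; _*_; _-_; _^_)
  import Data.Integer.Properties as ℤₚ
  open import Data.Integer.Tactic.RingSolver using (solve-∀)
  open import Data.Bool using (Bool; true; false; _∧_; if_then_else_)
  open import Data.List using (List; []; _∷_; map; foldr)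
  open import Data.List.Relation.Unary.All using (All; []; _∷_)
  open import Data.Product using (_×_; _,_)
  open import Function using (_∘_)
  open import Relation.Binary.Definitions using (tri<; tri≈; tri>)
  open import Relation.Binary.PropositionalEquality
  open ≡-Reasoning

  sumTo : ℕ → (ℕ → ℤ) → ℤ
  sumTo zero    f = 0ℤ
  sumTo (suc M) f = f 0 + sumTo M (f ∘ suc)

  sumTo-cong : ∀ M {f g : ℕ → ℤ} → (∀ a → f a ≡ g a) → sumTo M f ≡ sumTo M g
  sumTo-cong zero    f≗g = refl
  sumTo-cong (suc M) f≗g = cong₂ _+_ (f≗g 0) (sumTo-cong M (f≗g ∘ suc))

  sumTo-zero : ∀ M → sumTo M (λ _ → 0ℤ) ≡ 0ℤ
  sumTo-zero zero    = refl
  sumTo-zero (suc M) = trans (ℤₚ.+-identityˡ _) (sumTo-zero M)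

  sumTo-+ : ∀ M (f g : ℕ → ℤ) → sumTo M (λ a → f a + g a) ≡ sumTo M f + sumTo M g
  sumTo-+ zero    f g = refl
  sumTo-+ (suc M) f g =
    trans (cong (λ z → f 0 + g 0 + z) (sumTo-+ M (f ∘ suc) (g ∘ suc))) (interchange (f 0) (g 0) _ _)
    where
    interchange : ∀ a b c d → a + b + (c + d) ≡ a + c + (b + d)
    interchange = solve-∀

  sumTo-minus : ∀ M (f g : ℕ → ℤ) → sumTo M (λ a → f a - g a) ≡ sumTo M f - sumTo M g
  sumTo-minus zero    f g = refl
  sumTo-minus (suc M) f g =
    trans (cong (λ z → f 0 - g 0 + z) (sumTo-minus M (f ∘ suc) (g ∘ suc))) (interchange (f 0) (g 0) _ _)
    where
    interchange : ∀ a b c d → a - b + (c - d) ≡ a + c - (b + d)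
    interchange = solve-∀

  sumTo-*ˡ : ∀ M k (f : ℕ → ℤ) → sumTo M (λ a → k * f a) ≡ k * sumTo M f
  sumTo-*ˡ zero    k f = sym (ℤₚ.*-zeroʳ k)
  sumTo-*ˡ (suc M) k f =
    trans (cong (λ z → k * f 0 + z) (sumTo-*ˡ M k (f ∘ suc))) (sym (ℤₚ.*-distribˡ-+ k (f 0) _))

  sumTo-*ʳ : ∀ M k (f : ℕ → ℤ) → sumTo M (λ a → f a * k) ≡ sumTo M f * k
  sumTo-*ʳ M k f =
    trans (sumTo-cong M (λ a → ℤₚ.*-comm (f a) k)) (trans (sumTo-*ˡ M k f) (ℤₚ.*-comm k _))

  δ : ℕ → ℕ → ℤ
  δ p P = if p ≡ᵇ P then 1ℤ else 0ℤ

  binomCoeff-suc-zero : ∀ p → binomCoeff (suc p) 0 ≡ - binomCoeff p 0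
  binomCoeff-suc-zero p = sign ((- 1ℤ) ^ p)
    where
    sign : ∀ x → (- 1ℤ) * x * + 1 ≡ - (x * + 1)
    sign = solve-∀

  -- Either a < p and the exponent drops by one, or p C suc a = 0.
  sign-shift : ∀ p a →
    (- 1ℤ) ^ (p ∸ a) * + (p C suc a) ≡ - ((- 1ℤ) ^ (p ∸ suc a) * + (p C suc a))
  sign-shift p a with ℕₚ.<-cmp a p
  ... | tri< a<p _ _ rewrite ℕₚ.+-∸-assoc 1 a<p = sign ((- 1ℤ) ^ (p ∸ suc a)) (+ (p C suc a))
    where
    sign : ∀ x y → (- 1ℤ) * x * y ≡ - (x * y)
    sign = solve-∀
  ... | tri≈ _ refl _ rewrite k>n⇒nCk≡0 (ℕₚ.n<1+n p) =
    trans (ℤₚ.*-zeroʳ ((- 1ℤ) ^ (p ∸ p))) (sym (cong -_ (ℤₚ.*-zeroʳ ((- 1ℤ) ^ (p ∸ suc p)))))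
  ... | tri> _ _ p<a rewrite k>n⇒nCk≡0 (ℕₚ.m<n⇒m<1+n p<a) =
    trans (ℤₚ.*-zeroʳ ((- 1ℤ) ^ (p ∸ a))) (sym (cong -_ (ℤₚ.*-zeroʳ ((- 1ℤ) ^ (p ∸ suc a)))))

  -- (x − 1)^(p+1) = x (x − 1)^p − (x − 1)^p, coefficientwise.
  binomCoeff-suc-suc : ∀ p a → binomCoeff (suc p) (suc a) ≡ binomCoeff p a - binomCoeff p (suc a)
  binomCoeff-suc-suc p a = begin
    s * + (suc p C suc a)                  ≡⟨ cong (λ z → s * + z) (nCk+nC[k+1]≡[n+1]C[k+1] p a) ⟨
    s * + (p C a ℕ.+ p C suc a)     ≡⟨ cong (s *_) (ℤₚ.pos-+ (p C a) (p C suc a)) ⟩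
    s * (+ (p C a) + + (p C suc a))        ≡⟨ ℤₚ.*-distribˡ-+ s (+ (p C a)) (+ (p C suc a)) ⟩
    s * + (p C a) + s * + (p C suc a)      ≡⟨ cong (λ z → s * + (p C a) + z) (sign-shift p a) ⟩
    binomCoeff p a - binomCoeff p (suc a)  ∎
    where
    s : ℤ
    s = (- 1ℤ) ^ (p ∸ a)

  -- For a polynomial with coefficients f of degree below M, its coefficient of (x − 1)^P.
  taylor : ℕ → ℕ → (ℕ → ℤ) → ℤ
  taylor M P f = sumTo M (λ a → + (a C P) * f a)

  taylor-pascal : ∀ M p → (∀ P → taylor M P (binomCoeff p) ≡ δ p P) →
    ∀ P → sumTo M (λ a → + (suc a C P) * binomCoeff p a) ≡ δ (suc p) P + δ p P
  taylor-pascal M p ih zero    = trans (ih 0) (sym (ℤₚ.+-identityˡ (δ p 0)))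
  taylor-pascal M p ih (suc P) = begin
    sumTo M (λ a → + (suc a C suc P) * binomCoeff p a)
      ≡⟨ sumTo-cong M pascal ⟩
    sumTo M (λ a → + (a C P) * binomCoeff p a + + (a C suc P) * binomCoeff p a)
      ≡⟨ sumTo-+ M _ _ ⟩
    taylor M P (binomCoeff p) + taylor M (suc P) (binomCoeff p)
      ≡⟨ cong₂ _+_ (ih P) (ih (suc P)) ⟩
    δ p P + δ p (suc P) ∎
    where
    pascal : ∀ a → + (suc a C suc P) * binomCoeff p a
                 ≡ + (a C P) * binomCoeff p a + + (a C suc P) * binomCoeff p a
    pascal a = begin
      + (suc a C suc P) * b            ≡⟨ cong (λ z → + z * b) (nCk+nC[k+1]≡[n+1]C[k+1] a P) ⟨
      + (a C P ℕ.+ a C suc P) * b      ≡⟨ cong (_* b) (ℤₚ.pos-+ (a C P) (a C suc P)) ⟩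
      (+ (a C P) + + (a C suc P)) * b  ≡⟨ ℤₚ.*-distribʳ-+ b (+ (a C P)) (+ (a C suc P)) ⟩
      + (a C P) * b + + (a C suc P) * b ∎
      where
      b : ℤ
      b = binomCoeff p a

  taylor-binomCoeff : ∀ {p M} P → p < M → taylor M P (binomCoeff p) ≡ δ p P
  taylor-binomCoeff {zero} {suc M} P _ =
    trans (cong (λ z → + (0 C P) * binomCoeff 0 0 + z)
                (trans (sumTo-cong M (λ a → ℤₚ.*-zeroʳ (+ (suc a C P)))) (sumTo-zero M)))
          (trans (ℤₚ.+-identityʳ _) (constant-term P))
    where
    constant-term : ∀ P → + (0 C P) * binomCoeff 0 0 ≡ δ 0 P
    constant-term zero    = refl
    constant-term (suc P) = refl
  taylor-binomCoeff {suc p} {suc M} P (s≤s p<M) = begin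
    c 0 * binomCoeff (suc p) 0 + sumTo M (λ a → c (suc a) * binomCoeff (suc p) (suc a))
      ≡⟨ cong₂ _+_ (trans (cong (c 0 *_) (binomCoeff-suc-zero p)) (sym (ℤₚ.neg-distribʳ-* (c 0) _)))
                   (trans (sumTo-cong M (λ a → trans (cong (c (suc a) *_) (binomCoeff-suc-suc p a))
                                                     (*-distribˡ-minus (c (suc a)) _ _)))
                          (sumTo-minus M _ _)) ⟩
    - Z + (X - Y)                ≡⟨ rearrange Z X Y ⟩
    X - (Z + Y)                  ≡⟨ cong (λ z → X - z) (taylor-binomCoeff P (ℕₚ.m<n⇒m<1+n p<M)) ⟩
    X - δ p P                    ≡⟨ cong (λ z → z - δ p P) (taylor-pascal M p (λ P → taylor-binomCoeff P p<M) P) ⟩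
    δ (suc p) P + δ p P - δ p P  ≡⟨ cancel (δ (suc p) P) (δ p P) ⟩
    δ (suc p) P                  ∎
    where
    c : ℕ → ℤ
    c a = + (a C P)
    Z X Y : ℤ
    Z = c 0 * binomCoeff p 0
    X = sumTo M (λ a → c (suc a) * binomCoeff p a)
    Y = sumTo M (λ a → c (suc a) * binomCoeff p (suc a))
    *-distribˡ-minus : ∀ k x y → k * (x - y) ≡ k * x - k * y
    *-distribˡ-minus = solve-∀
    rearrange : ∀ z x y → - z + (x - y) ≡ x - (z + y)
    rearrange = solve-∀
    cancel : ∀ x y → x + y - y ≡ x
    cancel = solve-∀

  -- The coefficient of (x − 1)^P (y − 1)^Q of a two-variable polynomial of degrees below M.
  taylor₂ : ℕ → ℕ → ℕ → (ℕ → ℕ → ℤ) → ℤ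
  taylor₂ M P Q T = sumTo M (λ a → sumTo M (λ b → + (a C P) * + (b C Q) * T a b))

  taylor₂-cong : ∀ M P Q {S T : ℕ → ℕ → ℤ} → (∀ a b → S a b ≡ T a b) → taylor₂ M P Q S ≡ taylor₂ M P Q T
  taylor₂-cong M P Q S≗T =
    sumTo-cong M (λ a → sumTo-cong M (λ b → cong (+ (a C P) * + (b C Q) *_) (S≗T a b)))

  taylor₂-zero : ∀ M P Q → taylor₂ M P Q (λ _ _ → 0ℤ) ≡ 0ℤ
  taylor₂-zero M P Q =
    trans (sumTo-cong M (λ a → trans (sumTo-cong M (λ b → ℤₚ.*-zeroʳ (+ (a C P) * + (b C Q))))
                                     (sumTo-zero M)))
          (sumTo-zero M)

  taylor₂-+ : ∀ M P Q (S T : ℕ → ℕ → ℤ) →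
    taylor₂ M P Q (λ a b → S a b + T a b) ≡ taylor₂ M P Q S + taylor₂ M P Q T
  taylor₂-+ M P Q S T =
    trans (sumTo-cong M (λ a → trans (sumTo-cong M (λ b → ℤₚ.*-distribˡ-+ (+ (a C P) * + (b C Q)) _ _))
                                     (sumTo-+ M _ _)))
          (sumTo-+ M _ _)

  taylor₂-product : ∀ {p q M} P Q → p < M → q < M →
    taylor₂ M P Q (λ a b → binomCoeff p a * binomCoeff q b) ≡ δ p P * δ q Q
  taylor₂-product {p} {q} {M} P Q p<M q<M = begin
    taylor₂ M P Q (λ a b → binomCoeff p a * binomCoeff q b)
      ≡⟨ sumTo-cong M (λ a → trans (sumTo-cong M (λ b → interchange (+ (a C P)) (+ (b C Q)) _ _))
                                   (sumTo-*ˡ M (+ (a C P) * binomCoeff p a) _)) ⟩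
    sumTo M (λ a → + (a C P) * binomCoeff p a * taylor M Q (binomCoeff q))
      ≡⟨ sumTo-*ʳ M _ _ ⟩
    taylor M P (binomCoeff p) * taylor M Q (binomCoeff q)
      ≡⟨ cong₂ _*_ (taylor-binomCoeff P p<M) (taylor-binomCoeff Q q<M) ⟩
    δ p P * δ q Q ∎
    where
    interchange : ∀ u v w z → u * v * (w * z) ≡ u * w * (v * z)
    interchange = solve-∀

  indicator-∧ : ∀ b c k →
    (if b then 1ℤ else 0ℤ) * (if c then 1ℤ else 0ℤ) + + k ≡ + (if b ∧ c then suc k else k)
  indicator-∧ true  true  k = refl
  indicator-∧ true  false k = refl
  indicator-∧ false c     k = refl

  taylor₂-sum-of-products : ∀ {X : Set} {M} P Q (p q : X → ℕ) (L : List X) →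
    All (λ x → p x < M × q x < M) L →
    taylor₂ M P Q (λ a b → foldr _+_ 0ℤ (map (λ x → binomCoeff (p x) a * binomCoeff (q x) b) L))
      ≡ + count (λ x → (p x ≡ᵇ P) ∧ (q x ≡ᵇ Q)) L
  taylor₂-sum-of-products {M = M} P Q p q [] [] = taylor₂-zero M P Q
  taylor₂-sum-of-products {M = M} P Q p q (x ∷ L) ((px<M , qx<M) ∷ bounded) = begin
    taylor₂ M P Q (λ a b → binomCoeff (p x) a * binomCoeff (q x) b + T a b)
      ≡⟨ taylor₂-+ M P Q _ T ⟩
    taylor₂ M P Q (λ a b → binomCoeff (p x) a * binomCoeff (q x) b) + taylor₂ M P Q T
      ≡⟨ cong₂ _+_ (taylor₂-product P Q px<M qx<M) (taylor₂-sum-of-products P Q p q L bounded) ⟩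
    δ (p x) P * δ (q x) Q + + count (λ x → (p x ≡ᵇ P) ∧ (q x ≡ᵇ Q)) L
      ≡⟨ indicator-∧ (p x ≡ᵇ P) (q x ≡ᵇ Q) _ ⟩
    + count (λ x → (p x ≡ᵇ P) ∧ (q x ≡ᵇ Q)) (x ∷ L) ∎
    where
    T : ℕ → ℕ → ℤ
    T a b = foldr _+_ 0ℤ (map (λ x → binomCoeff (p x) a * binomCoeff (q x) b) L)

open BinomialInversion using (taylor₂; taylor₂-cong; taylor₂-sum-of-products)

open import Data.Nat as ℕ using (ℕ; zero; suc; _+_; _∸_; _≡ᵇ_; _≤ᵇ_; _≤_; s≤s; z≤n)
import Data.Nat.Properties as ℕₚ
open import Data.Nat.Tactic.RingSolver using (solve-∀)
import Data.Integer as ℤ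
import Data.Integer.Properties as ℤₚ
open import Data.Bool using (Bool; true; false; _∧_; _∨_; not; if_then_else_)
open import Data.Bool.Properties using (∧-identityʳ; ∧-zeroʳ; ∨-conicalˡ; ∨-conicalʳ; ¬-not; not-injective)
open import Data.Bool.ListAction using (any; all)
open import Data.Fin as Fin using (Fin; toℕ; _<_)
import Data.Fin.Properties as Finₚ
open import Data.List using (List; []; _∷_; _++_; map; length; tabulate; allFin; concatMap)
open import Data.List.Properties using (++-identityʳ)
open import Data.List.Relation.Unary.All as All using (All; []; _∷_)
import Data.List.Relation.Unary.All.Properties as Allₚ
open import Data.Product using (_×_; _,_; ∃; proj₁; proj₂)
open import Data.Sum using (_⊎_; inj₁; inj₂)
open import Data.Empty using (⊥; ⊥-elim)
open import Function using (_∘_)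
open import Relation.Nullary using (¬_; yes; no)
open import Relation.Nullary.Decidable using (⌊_⌋)
open import Relation.Binary.Definitions using (tri<; tri≈; tri>)
open import Relation.Binary.PropositionalEquality

∨-elim : ∀ {a b} → a ∨ b ≡ true → a ≡ true ⊎ b ≡ true
∨-elim {true}  _ = inj₁ refl
∨-elim {false} h = inj₂ h

∨-introˡ : ∀ {a} b → a ≡ true → a ∨ b ≡ true
∨-introˡ b refl = refl

∨-introʳ : ∀ a {b} → b ≡ true → a ∨ b ≡ true
∨-introʳ true  _ = refl
∨-introʳ false h = h

∧-elim : ∀ {a b} → a ∧ b ≡ true → a ≡ true × b ≡ true
∧-elim {true} {true} _ = refl , refl

∧-intro : ∀ {a b} → a ≡ true → b ≡ true → a ∧ b ≡ true
∧-intro refl refl = refl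

≡ᵇ-refl : ∀ m → (m ≡ᵇ m) ≡ true
≡ᵇ-refl zero    = refl
≡ᵇ-refl (suc m) = ≡ᵇ-refl m

≡ᵇ⇒≡ : ∀ m k → (m ≡ᵇ k) ≡ true → m ≡ k
≡ᵇ⇒≡ zero    zero    _ = refl
≡ᵇ⇒≡ (suc m) (suc k) h = cong suc (≡ᵇ⇒≡ m k h)

≢⇒≡ᵇ-false : ∀ m k → ¬ m ≡ k → (m ≡ᵇ k) ≡ false
≢⇒≡ᵇ-false zero    zero    m≢k = ⊥-elim (m≢k refl)
≢⇒≡ᵇ-false zero    (suc k) m≢k = refl
≢⇒≡ᵇ-false (suc m) zero    m≢k = refl
≢⇒≡ᵇ-false (suc m) (suc k) m≢k = ≢⇒≡ᵇ-false m k (m≢k ∘ cong suc)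

==-refl : ∀ {n} (a : Fin n) → (a == a) ≡ true
==-refl a with a Finₚ.≟ a
... | yes _   = refl
... | no  a≢a = ⊥-elim (a≢a refl)

==⇒≡ : ∀ {n} {a b : Fin n} → (a == b) ≡ true → a ≡ b
==⇒≡ {a = a} {b} h with a Finₚ.≟ b
... | yes a≡b = a≡b

≢⇒==-false : ∀ {n} {a b : Fin n} → ¬ a ≡ b → (a == b) ≡ false
≢⇒==-false {a = a} {b} a≢b with a Finₚ.≟ b
... | yes a≡b = ⊥-elim (a≢b a≡b)
... | no  _   = refl

_<ᵛ_ : ∀ {n} → Fin n → Fin n → Bool
w <ᵛ v = ⌊ toℕ w ℕ.<? toℕ v ⌋

<ᵛ⇒< : ∀ {n} {w v : Fin n} → w <ᵛ v ≡ true → w < v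
<ᵛ⇒< {w = w} {v} h with toℕ w ℕ.<? toℕ v
... | yes w<v = w<v

<⇒<ᵛ : ∀ {n} {w v : Fin n} → w < v → w <ᵛ v ≡ true
<⇒<ᵛ {w = w} {v} w<v with toℕ w ℕ.<? toℕ v
... | yes _   = refl
... | no  w≮v = ⊥-elim (w≮v w<v)

<ᵛ-irrefl : ∀ {n} {w : Fin n} → w <ᵛ w ≡ true → ⊥
<ᵛ-irrefl {w = w} h = Finₚ.<-irrefl refl (<ᵛ⇒< {w = w} {v = w} h)

any-++⁺ : ∀ {X : Set} {p q : X → Bool} (L Y : List X) → (∀ x → p x ≡ true → q x ≡ true) →
  any p L ≡ true → any q (L ++ Y) ≡ true
any-++⁺ {p = p} {q} (x ∷ L) Y p⇒q h with ∨-elim {p x} h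
... | inj₁ px = ∨-introˡ _ (p⇒q x px)
... | inj₂ pL = ∨-introʳ (q x) (any-++⁺ L Y p⇒q pL)

any-witness : ∀ {X : Set} {p : X → Bool} {Q : X → Set} (L : List X) → All Q L → any p L ≡ true →
  ∃ λ x → Q x × p x ≡ true
any-witness {p = p} (x ∷ L) (qx ∷ qL) h with ∨-elim {p x} h
... | inj₁ px = x , qx , px
... | inj₂ pL = any-witness L qL pL

all-tabulate-false : ∀ {X : Set} {n} (p : X → Bool) (f : Fin n → X) (w : Fin n) →
  p (f w) ≡ false → all p (tabulate f) ≡ false
all-tabulate-false p f Fin.zero    h rewrite h = refl
all-tabulate-false p f (Fin.suc w) h with p (f Fin.zero)
... | true  = all-tabulate-false p (f ∘ Fin.suc) w h
... | false = refl

all-tabulate-false⁻ : ∀ {X : Set} {n} (p : X → Bool) (f : Fin n → X) →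
  all p (tabulate f) ≡ false → ∃ λ w → p (f w) ≡ false
all-tabulate-false⁻ {n = suc n} p f h with p (f Fin.zero) in eq
... | false = Fin.zero , eq
... | true with all-tabulate-false⁻ p (f ∘ Fin.suc) h
...   | w , hw = Fin.suc w , hw

-- Counting

countFin : (n : ℕ) → (Fin n → Bool) → ℕ
countFin zero    q = 0
countFin (suc n) q = if q Fin.zero then suc (countFin n (q ∘ Fin.suc)) else countFin n (q ∘ Fin.suc)

count-tabulate : ∀ {X : Set} {n} (p : X → Bool) (f : Fin n → X) →
  count p (tabulate f) ≡ countFin n (p ∘ f)
count-tabulate {n = zero}  p f = refl
count-tabulate {n = suc n} p f with p (f Fin.zero)
... | true  = cong suc (count-tabulate p (f ∘ Fin.suc))
... | false = count-tabulate p (f ∘ Fin.suc)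

countFin-none : ∀ n (q : Fin n → Bool) → (∀ v → q v ≡ false) → countFin n q ≡ 0
countFin-none zero    q none = refl
countFin-none (suc n) q none rewrite none Fin.zero = countFin-none n (q ∘ Fin.suc) (none ∘ Fin.suc)

countFin-≤ : ∀ n (q : Fin n → Bool) → countFin n q ≤ n
countFin-≤ zero    q = z≤n
countFin-≤ (suc n) q with q Fin.zero
... | true  = s≤s (countFin-≤ n _)
... | false = ℕₚ.m≤n⇒m≤1+n (countFin-≤ n _)

countFin-≤-pred : ∀ n (q : Fin (suc n) → Bool) → q Fin.zero ≡ false → countFin (suc n) q ≤ n
countFin-≤-pred n q q0 rewrite q0 = countFin-≤ n _

countFin-≤1 : ∀ n (q : Fin n → Bool) (m : Fin n) → (∀ v → q v ≡ true → v ≡ m) → countFin n q ≤ 1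
countFin-≤1 (suc n) q Fin.zero only-0 with q Fin.zero
... | true  = s≤s (ℕₚ.≤-reflexive (countFin-none n _ rest))
  where
  rest : ∀ v → q (Fin.suc v) ≡ false
  rest v = ¬-not (Finₚ.0≢1+n ∘ sym ∘ only-0 (Fin.suc v))
... | false = ℕₚ.≤-trans (ℕₚ.≤-reflexive (countFin-none n _ rest)) z≤n
  where
  rest : ∀ v → q (Fin.suc v) ≡ false
  rest v = ¬-not (Finₚ.0≢1+n ∘ sym ∘ only-0 (Fin.suc v))
countFin-≤1 (suc n) q (Fin.suc m) only-m
  rewrite ¬-not {q Fin.zero} (Finₚ.0≢1+n ∘ only-m Fin.zero) =
  countFin-≤1 n (q ∘ Fin.suc) m (λ v e → Finₚ.suc-injective (only-m (Fin.suc v) e))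

countFin-≥1 : ∀ n (q : Fin n → Bool) (m : Fin n) → q m ≡ true → 1 ≤ countFin n q
countFin-≥1 (suc n) q Fin.zero    qm rewrite qm = s≤s z≤n
countFin-≥1 (suc n) q (Fin.suc m) qm with q Fin.zero
... | true  = s≤s z≤n
... | false = countFin-≥1 n (q ∘ Fin.suc) m qm

countFin-≥2 : ∀ n (q : Fin n → Bool) (m₁ m₂ : Fin n) → q m₁ ≡ true → q m₂ ≡ true → ¬ m₁ ≡ m₂ →
  2 ≤ countFin n q
countFin-≥2 (suc n) q Fin.zero     Fin.zero     _   _   m₁≢m₂ = ⊥-elim (m₁≢m₂ refl)
countFin-≥2 (suc n) q Fin.zero     (Fin.suc m₂) qm₁ qm₂ _ rewrite qm₁ = s≤s (countFin-≥1 n _ m₂ qm₂)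
countFin-≥2 (suc n) q (Fin.suc m₁) Fin.zero     qm₁ qm₂ _ rewrite qm₂ = s≤s (countFin-≥1 n _ m₁ qm₁)
countFin-≥2 (suc n) q (Fin.suc m₁) (Fin.suc m₂) qm₁ qm₂ m₁≢m₂ with q Fin.zero
... | true  = ℕₚ.m≤n⇒m≤1+n (countFin-≥2 n _ m₁ m₂ qm₁ qm₂ (m₁≢m₂ ∘ cong Fin.suc))
... | false = countFin-≥2 n _ m₁ m₂ qm₁ qm₂ (m₁≢m₂ ∘ cong Fin.suc)

countFin-mono : ∀ n (q q′ : Fin n → Bool) → (∀ v → q v ≡ true → q′ v ≡ true) →
  countFin n q ≤ countFin n q′
countFin-mono zero    q q′ q⇒q′ = z≤n
countFin-mono (suc n) q q′ q⇒q′ with q Fin.zero in eq | q′ Fin.zero in eq′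
... | true  | true  = s≤s (countFin-mono n _ _ (q⇒q′ ∘ Fin.suc))
... | false | true  = ℕₚ.m≤n⇒m≤1+n (countFin-mono n _ _ (q⇒q′ ∘ Fin.suc))
... | false | false = countFin-mono n _ _ (q⇒q′ ∘ Fin.suc)
... | true  | false with trans (sym (q⇒q′ Fin.zero eq)) eq′
...   | ()

countFin-complement : ∀ n (q : Fin n → Bool) → countFin n q + countFin n (not ∘ q) ≡ n
countFin-complement zero    q = refl
countFin-complement (suc n) q with q Fin.zero
... | true  = cong suc (countFin-complement n _)
... | false = trans (ℕₚ.+-suc _ _) (cong suc (countFin-complement n _))

indicator : Bool → ℕ
indicator b = if b then 1 else 0

count-∷ : ∀ {X : Set} (p : X → Bool) x xs → count p (x ∷ xs) ≡ indicator (p x) + count p xs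
count-∷ p x xs with p x
... | true  = refl
... | false = refl

count-++ : ∀ {X : Set} (p : X → Bool) (L₁ L₂ : List X) → count p (L₁ ++ L₂) ≡ count p L₁ + count p L₂
count-++ p []       L₂ = refl
count-++ p (x ∷ L₁) L₂ with p x
... | true  = cong suc (count-++ p L₁ L₂)
... | false = count-++ p L₁ L₂

count-map : ∀ {X Y : Set} (p : Y → Bool) (f : X → Y) (L : List X) → count p (map f L) ≡ count (p ∘ f) L
count-map p f []      = refl
count-map p f (x ∷ L) with p (f x)
... | true  = cong suc (count-map p f L)
... | false = count-map p f L

count-cong : ∀ {X : Set} {p q : X → Bool} (L : List X) → (∀ x → p x ≡ q x) → count p L ≡ count q L
count-cong []      p≗q = refl
count-cong {p = p} {q} (x ∷ L) p≗q rewrite count-∷ p x L | count-∷ q x L | p≗q x =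
  cong (indicator (q x) +_) (count-cong L p≗q)

count-none : ∀ {X : Set} (p : X → Bool) (L : List X) → (∀ x → p x ≡ false) → count p L ≡ 0
count-none p []      none = refl
count-none p (x ∷ L) none rewrite none x = count-none p L none

count-split : ∀ {X : Set} {p q₁ q₂ : X → Bool} (L : List X) →
  (∀ x → indicator (p x) ≡ indicator (q₁ x) + indicator (q₂ x)) → count p L ≡ count q₁ L + count q₂ L
count-split []      split = refl
count-split {p = p} {q₁} {q₂} (x ∷ L) split
  rewrite count-∷ p x L | count-∷ q₁ x L | count-∷ q₂ x L | split x | count-split {p = p} {q₁} {q₂} L split =
  interchange (indicator (q₁ x)) (indicator (q₂ x)) (count q₁ L) (count q₂ L)
  where
  interchange : ∀ a b c d → a + b + (c + d) ≡ a + c + (b + d)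
  interchange = solve-∀

count-witness : ∀ {X : Set} (p : X → Bool) (L : List X) → 1 ≤ count p L → ∃ λ x → p x ≡ true
count-witness p (x ∷ L) h with p x in eq
... | true  = x , eq
... | false = count-witness p L h

-- Reachability and rank

Edge : ℕ → Set
Edge n = Fin n × Fin n

_⊆ᵇ_ : ∀ {n} → (Fin n → Bool) → (Fin n → Bool) → Set
R ⊆ᵇ R′ = ∀ w → R w ≡ true → R′ w ≡ true

step-⊆-++ : ∀ {n} (A X : List (Edge n)) {R R′ : Fin n → Bool} → R ⊆ᵇ R′ → step A R ⊆ᵇ step (A ++ X) R′
step-⊆-++ A X {R} {R′} R⊆R′ w h with ∨-elim {R w} h
... | inj₁ Rw   = ∨-introˡ _ (R⊆R′ w Rw)
... | inj₂ hop = ∨-introʳ (R′ w) (any-++⁺ A X hop-⊆ hop)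
  where
  hop-⊆ : ∀ e → ((R (proj₁ e) ∧ (proj₂ e == w)) ∨ (R (proj₂ e) ∧ (proj₁ e == w))) ≡ true →
                ((R′ (proj₁ e) ∧ (proj₂ e == w)) ∨ (R′ (proj₂ e) ∧ (proj₁ e == w))) ≡ true
  hop-⊆ (a , b) h′ with ∨-elim {R a ∧ (b == w)} h′
  ... | inj₁ h₁ = ∨-introˡ _ (∧-intro (R⊆R′ a (proj₁ (∧-elim h₁))) (proj₂ (∧-elim h₁)))
  ... | inj₂ h₂ = ∨-introʳ (R′ a ∧ (b == w)) (∧-intro (R⊆R′ b (proj₁ (∧-elim h₂))) (proj₂ (∧-elim {R b} h₂)))

step-⊆ : ∀ {n} (A : List (Edge n)) {R R′ : Fin n → Bool} → R ⊆ᵇ R′ → step A R ⊆ᵇ step A R′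
step-⊆ A {R} {R′} R⊆R′ w h = subst (λ B → step B R′ w ≡ true) (++-identityʳ A) (step-⊆-++ A [] R⊆R′ w h)

step-extensive : ∀ {n} (A : List (Edge n)) (R : Fin n → Bool) → R ⊆ᵇ step A R
step-extensive A R w Rw = ∨-introˡ _ Rw

iter-⊆-++ : ∀ {n} t (A X : List (Edge n)) {R R′ : Fin n → Bool} → R ⊆ᵇ R′ →
  iter t (step A) R ⊆ᵇ iter t (step (A ++ X)) R′
iter-⊆-++ zero    A X R⊆R′ = R⊆R′
iter-⊆-++ (suc t) A X R⊆R′ = step-⊆-++ A X (iter-⊆-++ t A X R⊆R′)

iter-extensive : ∀ {n} t (A : List (Edge n)) (R : Fin n → Bool) → R ⊆ᵇ iter t (step A) R
iter-extensive zero    A R w Rw = Rw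
iter-extensive (suc t) A R w Rw = step-extensive A (iter t (step A) R) w (iter-extensive t A R w Rw)

iter-closed : ∀ {n} t (A : List (Edge n)) {R C : Fin n → Bool} → step A C ⊆ᵇ C → R ⊆ᵇ C →
  iter t (step A) R ⊆ᵇ C
iter-closed zero    A closed R⊆C = R⊆C
iter-closed (suc t) A closed R⊆C w h = closed w (step-⊆ A (iter-closed t A closed R⊆C) w h)

reachable-++ : ∀ {n} (A X : List (Edge n)) {v w : Fin n} → reachable A v w ≡ true → reachable (A ++ X) v w ≡ true
reachable-++ {n} A X {v} {w} = iter-⊆-++ n A X {R = v ==_} (λ _ h → h) w

Adjacent : ∀ {n} → List (Edge n) → Fin n → Fin n → Set
Adjacent A c d = ∀ R → R c ≡ true → step A R d ≡ true

Adjacent-there : ∀ {n} (e : Edge n) (A : List (Edge n)) {c d : Fin n} → Adjacent A c d → Adjacent (e ∷ A) c d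
Adjacent-there (a , b) A {c} {d} c→d R Rc with ∨-elim {R d} (c→d R Rc)
... | inj₁ Rd  = ∨-introˡ _ Rd
... | inj₂ hop = ∨-introʳ (R d) (∨-introʳ ((R a ∧ (b == d)) ∨ (R b ∧ (a == d))) hop)

Linked : ∀ {n} → List (Edge n) → Fin n → Fin n → Set
Linked A c d = Adjacent A c d × Adjacent A d c

Linked-sym : ∀ {n} {A : List (Edge n)} {c d : Fin n} → Linked A c d → Linked A d c
Linked-sym (c→d , d→c) = d→c , c→d

Linked-there : ∀ {n} (e : Edge n) (A : List (Edge n)) {c d : Fin n} → Linked A c d → Linked (e ∷ A) c d
Linked-there e A (c→d , d→c) = Adjacent-there e A c→d , Adjacent-there e A d→c

Linked-here : ∀ {n} (a b : Fin n) (A : List (Edge n)) → Linked ((a , b) ∷ A) a b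
Linked-here a b A = a→b , b→a
  where
  a→b : Adjacent ((a , b) ∷ A) a b
  a→b R Ra = ∨-introʳ (R b) (∨-introˡ _ (∨-introˡ _ (∧-intro Ra (==-refl b))))
  b→a : Adjacent ((a , b) ∷ A) b a
  b→a R Rb = ∨-introʳ (R a) (∨-introˡ _ (∨-introʳ (R a ∧ (b == a)) (∧-intro Rb (==-refl a))))

Adjacent⇒reachable : ∀ {n} (A : List (Edge n)) {c d : Fin n} → Adjacent A c d → reachable A c d ≡ true
Adjacent⇒reachable {suc t} A {c} {d} c→d =
  step-⊆ A (iter-extensive t A (c ==_)) d (c→d (c ==_) (==-refl c))

-- `reachable` iterates the closure n times, so a path of length two needs n ≥ 2.
Adjacent²⇒reachable : ∀ {n} (A : List (Edge n)) {c d f : Fin n} → 2 ≤ n →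
  Adjacent A c d → Adjacent A d f → reachable A c f ≡ true
Adjacent²⇒reachable {suc (suc t)} A {c} _ c→d d→f =
  step-⊆ A (step-⊆ A (iter-extensive t A (c ==_))) _ (d→f _ (c→d (c ==_) (==-refl c)))
Adjacent²⇒reachable {suc zero} A (s≤s ()) _ _

-- `components` counts the vertices that are least in their component, so the rank counts the others.
leastInComponent : ∀ {n} → List (Edge n) → Fin n → Bool
leastInComponent {n} A v = all (λ w → not ((w <ᵛ v) ∧ reachable A v w)) (allFin n)

notLeast : ∀ {n} → List (Edge n) → Fin n → Bool
notLeast A v = not (leastInComponent A v)

rank≡countFin-notLeast : ∀ {n} (A : List (Edge n)) → rank A ≡ countFin n (notLeast A)
rank≡countFin-notLeast {n} A = begin
  n ∸ count (leastInComponent A) (allFin n)    ≡⟨ cong (n ∸_) (count-tabulate (leastInComponent A) (λ v → v)) ⟩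
  n ∸ countFin n (leastInComponent A)          ≡⟨ cong (_∸ countFin n (leastInComponent A)) (countFin-complement n _) ⟨
  countFin n (leastInComponent A) + countFin n (notLeast A) ∸ countFin n (leastInComponent A)
                                               ≡⟨ ℕₚ.m+n∸m≡n (countFin n (leastInComponent A)) _ ⟩
  countFin n (notLeast A)                      ∎
  where open ≡-Reasoning

notLeast-intro : ∀ {n} (A : List (Edge n)) {v w : Fin n} →
  w <ᵛ v ≡ true → reachable A v w ≡ true → notLeast A v ≡ true
notLeast-intro A {v} {w} w<v v⇝w
  rewrite all-tabulate-false (λ w → not ((w <ᵛ v) ∧ reachable A v w)) (λ x → x) w (cong not (∧-intro w<v v⇝w)) = refl

notLeast-elim : ∀ {n} (A : List (Edge n)) {v : Fin n} → notLeast A v ≡ true →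
  ∃ λ w → w <ᵛ v ≡ true × reachable A v w ≡ true
notLeast-elim A {v} h with leastInComponent A v in least
... | false with all-tabulate-false⁻ (λ w → not ((w <ᵛ v) ∧ reachable A v w)) (λ x → x) least
...   | w , hw = w , ∧-elim (not-injective hw)

notLeast-zero : ∀ {n} (A : List (Edge (suc n))) → notLeast A Fin.zero ≡ false
notLeast-zero A = ¬-not (nothing-below-zero ∘ notLeast-elim A)
  where
  nothing-below-zero : (∃ λ w → w <ᵛ Fin.zero ≡ true × reachable A Fin.zero w ≡ true) → ⊥
  nothing-below-zero (w , w<0 , _) with <ᵛ⇒< {w = w} {v = Fin.zero} w<0
  ... | ()

rank-≤-pred : ∀ {n} (A : List (Edge n)) → rank A ≤ n ∸ 1
rank-≤-pred {zero}  A = ℕₚ.m∸n≤m 0 (components A)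
rank-≤-pred {suc n} A =
  ℕₚ.≤-trans (ℕₚ.≤-reflexive (rank≡countFin-notLeast A)) (countFin-≤-pred n (notLeast A) (notLeast-zero A))

rank-++ : ∀ {n} (A X : List (Edge n)) → rank A ≤ rank (A ++ X)
rank-++ {n} A X rewrite rank≡countFin-notLeast A | rank≡countFin-notLeast (A ++ X) = countFin-mono n _ _ grow
  where
  grow : ∀ v → notLeast A v ≡ true → notLeast (A ++ X) v ≡ true
  grow v h with notLeast-elim A h
  ... | w , w<v , v⇝w = notLeast-intro (A ++ X) w<v (reachable-++ A X v⇝w)

notLeast-Adjacent : ∀ {n} (A : List (Edge n)) {c d : Fin n} → Adjacent A d c → c < d →
  notLeast A d ≡ true
notLeast-Adjacent A d→c c<d = notLeast-intro A (<⇒<ᵛ c<d) (Adjacent⇒reachable A d→c)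

inPair : ∀ {n} → Fin n → Fin n → Fin n → Bool
inPair x y t = (t == x) ∨ (t == y)

inPair-elim : ∀ {n} {x y t : Fin n} → inPair x y t ≡ true → t ≡ x ⊎ t ≡ y
inPair-elim {t = t} h with ∨-elim {t == _} h
... | inj₁ t≡x = inj₁ (==⇒≡ t≡x)
... | inj₂ t≡y = inj₂ (==⇒≡ t≡y)

inPair-left : ∀ {n} (x y : Fin n) → inPair x y x ≡ true
inPair-left x y rewrite ==-refl x = refl

inPair-right : ∀ {n} (x y : Fin n) → inPair x y y ≡ true
inPair-right x y rewrite ==-refl y = ∨-introʳ (y == x) refl

LoopOrJoins : ∀ {n} → Fin n → Fin n → Edge n → Set
LoopOrJoins x y e = (isLoop e ∨ joins x y e) ≡ true

StaysOrInPair : ∀ {n} → Fin n → Fin n → Fin n → Fin n → Set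
StaysOrInPair x y a b = a ≡ b ⊎ (inPair x y a ≡ true × inPair x y b ≡ true)

LoopOrJoins⇒StaysOrInPair : ∀ {n} {x y a b : Fin n} → LoopOrJoins x y (a , b) →
  StaysOrInPair x y a b × StaysOrInPair x y b a
LoopOrJoins⇒StaysOrInPair {x = x} {y} {a} {b} h with ∨-elim {isLoop (a , b)} h
... | inj₁ loop = inj₁ (==⇒≡ loop) , inj₁ (sym (==⇒≡ loop))
... | inj₂ joins-xy with ∨-elim {(a == x) ∧ (b == y)} joins-xy
...   | inj₁ ab≡xy with ==⇒≡ (proj₁ (∧-elim {a == x} ab≡xy)) | ==⇒≡ (proj₂ (∧-elim {a == x} ab≡xy))
...     | refl | refl = inj₂ (inPair-left x y , inPair-right x y) , inj₂ (inPair-right x y , inPair-left x y)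
LoopOrJoins⇒StaysOrInPair {x = x} {y} {a} {b} h | inj₂ _ | inj₂ ab≡yx
  with ==⇒≡ (proj₁ (∧-elim {a == y} ab≡yx)) | ==⇒≡ (proj₂ (∧-elim {a == y} ab≡yx))
... | refl | refl = inj₂ (inPair-right x y , inPair-left x y) , inj₂ (inPair-left x y , inPair-right x y)

sameOrBothInPair : ∀ {n} → Fin n → Fin n → Fin n → Fin n → Bool
sameOrBothInPair x y v w = (v == w) ∨ (inPair x y v ∧ inPair x y w)

sameOrBothInPair-hop : ∀ {n} {x y v a w : Fin n} →
  sameOrBothInPair x y v a ≡ true → StaysOrInPair x y a w → sameOrBothInPair x y v w ≡ true
sameOrBothInPair-hop v~a (inj₁ refl) = v~a
sameOrBothInPair-hop {v = v} {a} {w} v~a (inj₂ (a∈ , w∈)) with ∨-elim {v == a} v~a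
... | inj₁ v≡a rewrite ==⇒≡ v≡a = ∨-introʳ (a == w) (∧-intro a∈ w∈)
... | inj₂ both = ∨-introʳ (v == w) (∧-intro (proj₁ (∧-elim both)) w∈)

reachable-confined : ∀ {n} {x y : Fin n} (A : List (Edge n)) → All (LoopOrJoins x y) A →
  ∀ {v w} → reachable A v w ≡ true → sameOrBothInPair x y v w ≡ true
reachable-confined {n} {x} {y} A confined {v} {w} = iter-closed n A closed (λ _ → ∨-introˡ _) w
  where
  closed : step A (sameOrBothInPair x y v) ⊆ᵇ sameOrBothInPair x y v
  closed w h with ∨-elim {sameOrBothInPair x y v w} h
  ... | inj₁ v~w = v~w
  ... | inj₂ hop with any-witness A confined hop
  ...   | (a , b) , ab-ok , via with ∨-elim {sameOrBothInPair x y v a ∧ (b == w)} via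
  ...     | inj₁ from-a = sameOrBothInPair-hop {x = x} {y} {v} (proj₁ (∧-elim from-a))
                (subst (StaysOrInPair x y a) (==⇒≡ (proj₂ (∧-elim {sameOrBothInPair x y v a} from-a)))
                       (proj₁ (LoopOrJoins⇒StaysOrInPair ab-ok)))
  ...     | inj₂ from-b = sameOrBothInPair-hop {x = x} {y} {v} (proj₁ (∧-elim {sameOrBothInPair x y v b} from-b))
                (subst (StaysOrInPair x y b) (==⇒≡ (proj₂ (∧-elim {sameOrBothInPair x y v b} from-b)))
                       (proj₂ (LoopOrJoins⇒StaysOrInPair ab-ok)))

rank-loops : ∀ {n} (A : List (Edge n)) → All (λ e → isLoop e ≡ true) A → rank A ≡ 0
rank-loops {n} A loops = trans (rank≡countFin-notLeast A) (countFin-none n _ least)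
  where
  least : ∀ v → notLeast A v ≡ false
  least v = ¬-not λ h → below-itself (notLeast-elim A h)
    where
    below-itself : (∃ λ w → w <ᵛ v ≡ true × reachable A v w ≡ true) → ⊥
    below-itself (w , w<v , v⇝w)
      with ∨-elim {v == w} (reachable-confined A (All.map (∨-introˡ _) loops) {v} v⇝w)
    ... | inj₁ v≡w rewrite ==⇒≡ v≡w = <ᵛ-irrefl w<v
    ... | inj₂ both with inPair-elim {x = v} {y = v} {t = w} (proj₂ (∧-elim {inPair v v v} both))
    ...   | inj₁ refl = <ᵛ-irrefl w<v
    ...   | inj₂ refl = <ᵛ-irrefl w<v

rank-≤1 : ∀ {n} (x y : Fin n) (A : List (Edge n)) → All (LoopOrJoins x y) A → rank A ≤ 1
rank-≤1 {n} x y A confined =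
  ℕₚ.≤-trans (ℕₚ.≤-reflexive (rank≡countFin-notLeast A)) (countFin-≤1 n _ larger only-larger)
  where
  larger : Fin n
  larger = if x <ᵛ y then y else x
  pick : ∀ {v w} → w <ᵛ v ≡ true → v ≡ x ⊎ v ≡ y → w ≡ x ⊎ w ≡ y → v ≡ larger
  pick w<v (inj₁ refl) (inj₁ refl) = ⊥-elim (<ᵛ-irrefl w<v)
  pick w<v (inj₂ refl) (inj₂ refl) = ⊥-elim (<ᵛ-irrefl w<v)
  pick w<v (inj₁ refl) (inj₂ refl) with x <ᵛ y in x<y
  ... | false = refl
  ... | true  = ⊥-elim (Finₚ.<-asym (<ᵛ⇒< {w = x} {v = y} x<y) (<ᵛ⇒< {w = y} {v = x} w<v))
  pick w<v (inj₂ refl) (inj₁ refl) with x <ᵛ y in x<y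
  ... | true  = refl
  ... | false with w<v
  ...   | ()
  only-larger : ∀ v → notLeast A v ≡ true → v ≡ larger
  only-larger v h with notLeast-elim A h
  ... | w , w<v , v⇝w with ∨-elim {v == w} (reachable-confined A confined v⇝w)
  ...   | inj₁ v≡w rewrite ==⇒≡ v≡w = ⊥-elim (<ᵛ-irrefl w<v)
  ...   | inj₂ both = pick w<v (inPair-elim (proj₁ (∧-elim both))) (inPair-elim (proj₂ (∧-elim {inPair x y v} both)))

≢⇒<⊎> : ∀ {n} {s t : Fin n} → ¬ s ≡ t → s < t ⊎ t < s
≢⇒<⊎> {s = s} {t} s≢t with Finₚ.<-cmp s t
... | tri< s<t _ _ = inj₁ s<t
... | tri≈ _ s≡t _ = ⊥-elim (s≢t s≡t)
... | tri> _ _ t<s = inj₂ t<s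

≢⇒2≤ : ∀ {n} {x y : Fin n} → ¬ x ≡ y → 2 ≤ n
≢⇒2≤ {suc zero}    {Fin.zero} {Fin.zero} x≢y = ⊥-elim (x≢y refl)
≢⇒2≤ {suc (suc n)} _ = s≤s (s≤s z≤n)

rank-≥1 : ∀ {n} (a b : Fin n) → ¬ a ≡ b → 1 ≤ rank ((a , b) ∷ [])
rank-≥1 {n} a b a≢b rewrite rank≡countFin-notLeast ((a , b) ∷ []) with ≢⇒<⊎> a≢b
... | inj₁ a<b = countFin-≥1 n _ b (notLeast-Adjacent ((a , b) ∷ []) (proj₂ (Linked-here a b [])) a<b)
... | inj₂ b<a = countFin-≥1 n _ a (notLeast-Adjacent ((a , b) ∷ []) (proj₁ (Linked-here a b [])) b<a)

-- The upper ends d₁, d₂ are not least; if they coincide, the larger of c₁, c₂ is not least either.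
rank-≥2-ordered : ∀ {n} (A : List (Edge n)) {c₁ d₁ c₂ d₂ : Fin n} → 2 ≤ n →
  Linked A c₁ d₁ → Linked A c₂ d₂ → c₁ < d₁ → c₂ < d₂ → ¬ (c₁ ≡ c₂ × d₁ ≡ d₂) →
  2 ≤ rank A
rank-≥2-ordered {n} A {c₁} {d₁} {c₂} {d₂} 2≤n (c₁→d₁ , d₁→c₁) (c₂→d₂ , d₂→c₂) c₁<d₁ c₂<d₂ distinct
  rewrite rank≡countFin-notLeast A with d₁ Finₚ.≟ d₂
... | no d₁≢d₂ =
  countFin-≥2 n _ d₁ d₂ (notLeast-Adjacent A d₁→c₁ c₁<d₁) (notLeast-Adjacent A d₂→c₂ c₂<d₂) d₁≢d₂
... | yes refl with c₁ Finₚ.≟ c₂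
...   | yes refl = ⊥-elim (distinct (refl , refl))
...   | no c₁≢c₂ with ≢⇒<⊎> c₁≢c₂
...     | inj₁ c₁<c₂ = countFin-≥2 n _ d₁ c₂ (notLeast-Adjacent A d₁→c₁ c₁<d₁)
            (notLeast-intro A (<⇒<ᵛ c₁<c₂) (Adjacent²⇒reachable A 2≤n c₂→d₂ d₁→c₁))
            (λ d₁≡c₂ → Finₚ.<-irrefl (sym d₁≡c₂) c₂<d₂)
...     | inj₂ c₂<c₁ = countFin-≥2 n _ d₁ c₁ (notLeast-Adjacent A d₁→c₁ c₁<d₁)
            (notLeast-intro A (<⇒<ᵛ c₂<c₁) (Adjacent²⇒reachable A 2≤n c₁→d₁ d₂→c₂))
            (λ d₁≡c₁ → Finₚ.<-irrefl (sym d₁≡c₁) c₁<d₁)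

joins-forward : ∀ {n} (x y : Fin n) → joins x y (x , y) ≡ true
joins-forward x y rewrite ==-refl x | ==-refl y = refl

joins-backward : ∀ {n} (x y : Fin n) → joins x y (y , x) ≡ true
joins-backward x y rewrite ==-refl x | ==-refl y = ∨-introʳ ((y == x) ∧ (x == y)) refl

rank-≥2 : ∀ {n} (x y a b : Fin n) → ¬ x ≡ y → ¬ a ≡ b → joins x y (a , b) ≡ false →
  2 ≤ rank ((a , b) ∷ (x , y) ∷ [])
rank-≥2 {n} x y a b x≢y a≢b not-parallel = go (≢⇒<⊎> a≢b) (≢⇒<⊎> x≢y)
  where
  A : List (Edge n)
  A = (a , b) ∷ (x , y) ∷ []
  ab : Linked A a b
  ab = Linked-here a b ((x , y) ∷ [])
  xy : Linked A x y
  xy = Linked-there (a , b) ((x , y) ∷ []) (Linked-here x y [])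
  parallel : joins x y (a , b) ≡ true → ⊥
  parallel h with trans (sym not-parallel) h
  ... | ()
  go : a < b ⊎ b < a → x < y ⊎ y < x → 2 ≤ rank A
  go (inj₁ a<b) (inj₁ x<y) = rank-≥2-ordered A (≢⇒2≤ x≢y) ab xy a<b x<y
    λ { (refl , refl) → parallel (joins-forward x y) }
  go (inj₁ a<b) (inj₂ y<x) = rank-≥2-ordered A (≢⇒2≤ x≢y) ab (Linked-sym {A = A} xy) a<b y<x
    λ { (refl , refl) → parallel (joins-backward x y) }
  go (inj₂ b<a) (inj₁ x<y) = rank-≥2-ordered A (≢⇒2≤ x≢y) (Linked-sym {A = A} ab) xy b<a x<y
    λ { (refl , refl) → parallel (joins-backward x y) }
  go (inj₂ b<a) (inj₂ y<x) = rank-≥2-ordered A (≢⇒2≤ x≢y) (Linked-sym {A = A} ab) (Linked-sym {A = A} xy) b<a y<x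
    λ { (refl , refl) → parallel (joins-forward x y) }

==-false⇒≢ : ∀ {n} {a b : Fin n} → (a == b) ≡ false → ¬ a ≡ b
==-false⇒≢ {a = a} a≠b refl with trans (sym a≠b) (==-refl a)
... | ()

rank-singleton≡ᵇ0 : ∀ {n} (e : Edge n) → (rank (e ∷ []) ≡ᵇ 0) ≡ isLoop e
rank-singleton≡ᵇ0 (a , b) with isLoop (a , b) in loop
... | true rewrite rank-loops ((a , b) ∷ []) (loop ∷ []) = refl
... | false with rank ((a , b) ∷ []) | rank-≥1 a b (==-false⇒≢ loop)
...   | suc _ | _ = refl

≤1⇒≤ᵇ1 : ∀ m → m ≤ 1 → (m ≤ᵇ 1) ≡ true
≤1⇒≤ᵇ1 zero          _ = refl
≤1⇒≤ᵇ1 (suc zero)    _ = refl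
≤1⇒≤ᵇ1 (suc (suc m)) (s≤s ())

2≤⇒≤ᵇ1-false : ∀ m → 2 ≤ m → (m ≤ᵇ 1) ≡ false
2≤⇒≤ᵇ1-false (suc (suc m)) _         = refl
2≤⇒≤ᵇ1-false (suc zero)    (s≤s ())

rank-pair≤ᵇ1 : ∀ {n} (x y : Fin n) → ¬ x ≡ y → (e : Edge n) →
  (rank (e ∷ (x , y) ∷ []) ≤ᵇ 1) ≡ (isLoop e ∨ joins x y e)
rank-pair≤ᵇ1 x y x≢y (a , b) with isLoop (a , b) ∨ joins x y (a , b) in loop-or-parallel
... | true  = ≤1⇒≤ᵇ1 _ (rank-≤1 x y _ (loop-or-parallel ∷ ∨-introʳ (isLoop (x , y)) (joins-forward x y) ∷ []))
... | false = 2≤⇒≤ᵇ1-false _ (rank-≥2 x y a b x≢y (==-false⇒≢ (∨-conicalˡ _ (joins x y (a , b)) loop-or-parallel))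
                                                    (∨-conicalʳ (isLoop (a , b)) _ loop-or-parallel))

count-loops-or-joins : ∀ {n} (x y : Fin n) → ¬ x ≡ y → (E : List (Edge n)) →
  count (λ e → isLoop e ∨ joins x y e) E ≡ count isLoop E + count (joins x y) E
count-loops-or-joins x y x≢y E = count-split E disjoint
  where
  disjoint : ∀ e → indicator (isLoop e ∨ joins x y e) ≡ indicator (isLoop e) + indicator (joins x y e)
  disjoint (a , b) with isLoop (a , b) in loop | joins x y (a , b) in joins-xy
  ... | false | false = refl
  ... | false | true  = refl
  ... | true  | false = refl
  ... | true  | true with ==⇒≡ loop | ∨-elim {(a == x) ∧ (b == y)} joins-xy
  ...   | refl | inj₁ ax∧ay = ⊥-elim (x≢y (trans (sym (==⇒≡ (proj₁ (∧-elim {a == x} ax∧ay))))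
                                                   (==⇒≡ (proj₂ (∧-elim {a == x} ax∧ay)))))
  ...   | refl | inj₂ ay∧ax = ⊥-elim (x≢y (trans (sym (==⇒≡ (proj₂ (∧-elim {a == y} ay∧ax))))
                                                   (==⇒≡ (proj₁ (∧-elim {a == y} ay∧ax)))))

-- Sub-multisets of a list by size

count-subsets-∷ : ∀ {X : Set} (p : List X → Bool) x xs →
  count p (subsets (x ∷ xs)) ≡ count p (subsets xs) + count (p ∘ (x ∷_)) (subsets xs)
count-subsets-∷ p x xs =
  trans (count-++ p (subsets xs) _) (cong (count p (subsets xs) +_) (count-map p (x ∷_) (subsets xs)))

count-subsets-size0 : ∀ {X : Set} (f : List X → Bool) (L : List X) →
  count (λ A → (length A ≡ᵇ 0) ∧ f A) (subsets L) ≡ indicator (f [])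
count-subsets-size0 f [] with f []
... | true  = refl
... | false = refl
count-subsets-size0 f (x ∷ xs)
  rewrite count-subsets-∷ (λ A → (length A ≡ᵇ 0) ∧ f A) x xs | count-subsets-size0 f xs
        | count-none (λ A → (length (x ∷ A) ≡ᵇ 0) ∧ f (x ∷ A)) (subsets xs) (λ _ → refl) =
  ℕₚ.+-identityʳ _

count-subsets-size1 : ∀ {X : Set} (f : List X → Bool) (L : List X) →
  count (λ A → (length A ≡ᵇ 1) ∧ f A) (subsets L) ≡ count (λ e → f (e ∷ [])) L
count-subsets-size1 f [] = refl
count-subsets-size1 f (x ∷ xs)
  rewrite count-subsets-∷ (λ A → (length A ≡ᵇ 1) ∧ f A) x xs | count-subsets-size1 f xs
        | count-subsets-size0 (λ A → f (x ∷ A)) xs | count-∷ (λ e → f (e ∷ [])) x xs =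
  ℕₚ.+-comm (count (λ e → f (e ∷ [])) xs) (indicator (f (x ∷ [])))

countPairs : ∀ {X : Set} → (List X → Bool) → List X → ℕ
countPairs f []       = 0
countPairs f (x ∷ xs) = countPairs f xs + count (λ e → f (x ∷ e ∷ [])) xs

count-subsets-size2 : ∀ {X : Set} (f : List X → Bool) (L : List X) →
  count (λ A → (length A ≡ᵇ 2) ∧ f A) (subsets L) ≡ countPairs f L
count-subsets-size2 f [] = refl
count-subsets-size2 f (x ∷ xs)
  rewrite count-subsets-∷ (λ A → (length A ≡ᵇ 2) ∧ f A) x xs | count-subsets-size2 f xs
        | count-subsets-size1 (λ A → f (x ∷ A)) xs = refl

countPairs-∷ʳ : ∀ {X : Set} (f : List X → Bool) (L : List X) z →
  countPairs f (L ++ z ∷ []) ≡ countPairs f L + count (λ e → f (e ∷ z ∷ [])) L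
countPairs-∷ʳ f [] z = refl
countPairs-∷ʳ f (x ∷ xs) z
  rewrite countPairs-∷ʳ f xs z | count-++ (λ e → f (x ∷ e ∷ [])) xs (z ∷ [])
        | count-∷ (λ e → f (e ∷ z ∷ [])) x xs | count-∷ (λ e → f (x ∷ e ∷ [])) z [] =
  interchange (countPairs f xs) (count (λ e → f (e ∷ z ∷ [])) xs) (count (λ e → f (x ∷ e ∷ [])) xs)
              (indicator (f (x ∷ z ∷ [])))
  where
  interchange : ∀ a b c d → a + b + (c + (d + 0)) ≡ a + c + (d + 0 + b)
  interchange = solve-∀

subsets-length : ∀ {X : Set} (L : List X) → All (λ A → length A ≤ length L) (subsets L)
subsets-length []       = z≤n ∷ []
subsets-length (x ∷ xs) =
  Allₚ.++⁺ (All.map ℕₚ.m≤n⇒m≤1+n (subsets-length xs)) (Allₚ.map⁺ (All.map s≤s (subsets-length xs)))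

subsets-head : ∀ {X : Set} (L : List X) → ∃ λ rest → subsets L ≡ [] ∷ rest
subsets-head []       = [] , refl
subsets-head (x ∷ xs) with subsets-head xs
... | rest , eq rewrite eq = _ , refl

-- The rank generating polynomial

-- The coefficient of xᴾ yᑫ in the rank generating polynomial Σ_{A ⊆ E} x^(r(E) − r(A)) y^(|A| − r(A)),
-- which becomes the Tutte polynomial after substituting x − 1 and y − 1.
rankGenCoeff : ∀ {n} → List (Edge n) → ℕ → ℕ → ℕ
rankGenCoeff E P Q = count (λ A → ((rank E ∸ rank A) ≡ᵇ P) ∧ ((length A ∸ rank A) ≡ᵇ Q)) (subsets E)

SameRankGen : ∀ {m n} → List (Edge m) → List (Edge n) → Set
SameRankGen EX EY = ∀ P Q → rankGenCoeff EX P Q ≡ rankGenCoeff EY P Q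

taylor₂-tutteCoeff : ∀ (G : Graph) {M} P Q → n G + length (edges G) ℕ.< M →
  taylor₂ M P Q (tutteCoeff G) ≡ ℤ.+ rankGenCoeff (edges G) P Q
taylor₂-tutteCoeff G {M} P Q bound =
  taylor₂-sum-of-products P Q corank nullity (subsets (edges G)) (All.map (λ {A} → bounded {A}) (subsets-length (edges G)))
  where
  corank nullity : List (Edge (n G)) → ℕ
  corank A = rank (edges G) ∸ rank A
  nullity A = length A ∸ rank A
  bounded : ∀ {A : List (Edge (n G))} → length A ≤ length (edges G) → corank A ℕ.< M × nullity A ℕ.< M
  bounded {A} A≤E =
    ℕₚ.≤-<-trans (ℕₚ.≤-trans (ℕₚ.m∸n≤m (rank (edges G)) (rank A)) (ℕₚ.m∸n≤m (n G) (components (edges G))))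
                 (ℕₚ.≤-<-trans (ℕₚ.m≤m+n (n G) (length (edges G))) bound) ,
    ℕₚ.≤-<-trans (ℕₚ.≤-trans (ℕₚ.m∸n≤m (length A) (rank A)) A≤E)
                 (ℕₚ.≤-<-trans (ℕₚ.m≤n+m (length (edges G)) (n G)) bound)

TEquivalent⇒SameRankGen : ∀ (G H : Graph) → TEquivalent G H → SameRankGen (edges G) (edges H)
TEquivalent⇒SameRankGen G H T≡ P Q = ℤₚ.+-injective (begin
  ℤ.+ rankGenCoeff (edges G) P Q  ≡⟨ taylor₂-tutteCoeff G P Q (s≤s (ℕₚ.m≤m+n _ (n H + length (edges H)))) ⟨
  taylor₂ M P Q (tutteCoeff G)    ≡⟨ taylor₂-cong M P Q T≡ ⟩
  taylor₂ M P Q (tutteCoeff H)    ≡⟨ taylor₂-tutteCoeff H P Q (s≤s (ℕₚ.m≤n+m _ (n G + length (edges G)))) ⟩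
  ℤ.+ rankGenCoeff (edges H) P Q  ∎)
  where
  open ≡-Reasoning
  M : ℕ
  M = suc (n G + length (edges G) + (n H + length (edges H)))

RankMaximal : ∀ {n} → List (Edge n) → Set
RankMaximal {n} E = ∀ (A : List (Edge n)) → rank A ≤ rank E

RankMaximal-++ : ∀ {n} (E X : List (Edge n)) → RankMaximal E → RankMaximal (E ++ X)
RankMaximal-++ E X max A = ℕₚ.≤-trans (max A) (rank-++ E X)

connected⇒RankMaximal : ∀ (G : Graph) → Connected G → RankMaximal (edges G)
connected⇒RankMaximal G connected A =
  ℕₚ.≤-trans (rank-≤-pred A) (ℕₚ.≤-reflexive (cong (n G ∸_) (sym connected)))

m∸[1+k]≢m : ∀ m k → suc k ≤ m → ¬ (m ∸ suc k) ≡ m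
m∸[1+k]≢m (suc m) k _ eq = ℕₚ.<-irrefl refl (ℕₚ.≤-trans (ℕₚ.≤-reflexive (sym eq)) (ℕₚ.m∸n≤m m k))

corank-full : ∀ r s l Q → s ≤ r → (((r ∸ s) ≡ᵇ r) ∧ ((l ∸ s) ≡ᵇ Q)) ≡ ((l ≡ᵇ Q) ∧ (s ≡ᵇ 0))
corank-full r zero    l Q _   rewrite ≡ᵇ-refl r = sym (∧-identityʳ _)
corank-full r (suc s) l Q s<r rewrite ≢⇒≡ᵇ-false (r ∸ suc s) r (m∸[1+k]≢m r s s<r) = sym (∧-zeroʳ _)

corank-one : ∀ r s l → 1 ≤ r → s ≤ r → (((r ∸ s) ≡ᵇ (r ∸ 1)) ∧ ((l ∸ s) ≡ᵇ 1)) ≡ ((l ≡ᵇ 2) ∧ (s ≡ᵇ 1))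
corank-one (suc r) zero _ _ _ rewrite ≢⇒≡ᵇ-false (suc r) r (λ eq → ℕₚ.<-irrefl (sym eq) (ℕₚ.n<1+n r)) =
  sym (∧-zeroʳ _)
corank-one (suc r) (suc zero)    zero    _ _ rewrite ≡ᵇ-refl r = refl
corank-one (suc r) (suc zero)    (suc l) _ _ rewrite ≡ᵇ-refl r = sym (∧-identityʳ _)
corank-one (suc r) (suc (suc s)) l       _ (s≤s s<r) rewrite ≢⇒≡ᵇ-false (r ∸ suc s) r (m∸[1+k]≢m r s s<r) =
  sym (∧-zeroʳ _)

≤ᵇ1-split : ∀ s (b : Bool) → indicator (b ∧ (s ≤ᵇ 1)) ≡ indicator (b ∧ (s ≡ᵇ 0)) + indicator (b ∧ (s ≡ᵇ 1))
≤ᵇ1-split zero          true  = refl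
≤ᵇ1-split (suc zero)    true  = refl
≤ᵇ1-split (suc (suc s)) true  = refl
≤ᵇ1-split s             false = refl

rankGenCoeff-loops : ∀ {n} (E : List (Edge n)) → RankMaximal E → rankGenCoeff E (rank E) 1 ≡ count isLoop E
rankGenCoeff-loops E max =
  trans (count-cong (subsets E) (λ A → corank-full (rank E) (rank A) (length A) 1 (max A)))
        (trans (count-subsets-size1 (λ A → rank A ≡ᵇ 0) E) (count-cong E rank-singleton≡ᵇ0))

-- A pair of edges has rank at most 1 iff it has rank 0 and nullity 2, or rank 1 and nullity 1.
rankGenCoeff-pairs : ∀ {n} (E : List (Edge n)) → RankMaximal E → 1 ≤ rank E →
  rankGenCoeff E (rank E) 2 + rankGenCoeff E (rank E ∸ 1) 1 ≡ countPairs (λ A → rank A ≤ᵇ 1) E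
rankGenCoeff-pairs E max 1≤r =
  trans (cong₂ _+_ (count-cong (subsets E) (λ A → corank-full (rank E) (rank A) (length A) 2 (max A)))
                   (count-cong (subsets E) (λ A → corank-one (rank E) (rank A) (length A) 1≤r (max A))))
        (trans (sym (count-split (subsets E) (λ A → ≤ᵇ1-split (rank A) (length A ≡ᵇ 2))))
               (count-subsets-size2 (λ A → rank A ≤ᵇ 1) E))

-- The empty edge set is counted by rankGenCoeff E (rank E) 0, so EY has a subset of corank rank EX.
SameRankGen⇒rank≤ : ∀ {m n} (EX : List (Edge m)) (EY : List (Edge n)) → SameRankGen EX EY → rank EX ≤ rank EY
SameRankGen⇒rank≤ {m} EX EY same with count-witness _ (subsets EY) (subst (1 ≤_) (same (rank EX) 0) ∅-counted)
  where
  ∅-counted : 1 ≤ rankGenCoeff EX (rank EX) 0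
  ∅-counted with subsets-head EX
  ... | rest , eq rewrite eq | rank-loops {m} [] [] | ≡ᵇ-refl (rank EX) = s≤s z≤n
... | A , h = subst (_≤ rank EY) (≡ᵇ⇒≡ _ _ (proj₁ (∧-elim h))) (ℕₚ.m∸n≤m (rank EY) (rank A))

SameRankGen⇒rank≡ : ∀ {m n} (EX : List (Edge m)) (EY : List (Edge n)) → SameRankGen EX EY → rank EX ≡ rank EY
SameRankGen⇒rank≡ EX EY same =
  ℕₚ.≤-antisym (SameRankGen⇒rank≤ EX EY same) (SameRankGen⇒rank≤ EY EX (λ P Q → sym (same P Q)))

SameRankGen⇒count-loops≡ : ∀ {m n} (EX : List (Edge m)) (EY : List (Edge n)) →
  RankMaximal EX → RankMaximal EY → SameRankGen EX EY → count isLoop EX ≡ count isLoop EY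
SameRankGen⇒count-loops≡ EX EY maxX maxY same = begin
  count isLoop EX              ≡⟨ rankGenCoeff-loops EX maxX ⟨
  rankGenCoeff EX (rank EX) 1  ≡⟨ same (rank EX) 1 ⟩
  rankGenCoeff EY (rank EX) 1  ≡⟨ cong (λ r → rankGenCoeff EY r 1) (SameRankGen⇒rank≡ EX EY same) ⟩
  rankGenCoeff EY (rank EY) 1  ≡⟨ rankGenCoeff-loops EY maxY ⟩
  count isLoop EY              ∎
  where open ≡-Reasoning

rankAtMost1 : ∀ {n} → List (Edge n) → Bool
rankAtMost1 A = rank A ≤ᵇ 1

SameRankGen⇒countPairs≡ : ∀ {m n} (EX : List (Edge m)) (EY : List (Edge n)) →
  RankMaximal EX → RankMaximal EY → SameRankGen EX EY → 1 ≤ rank EX →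
  countPairs rankAtMost1 EX ≡ countPairs rankAtMost1 EY
SameRankGen⇒countPairs≡ EX EY maxX maxY same 1≤rX = begin
  countPairs rankAtMost1 EX
    ≡⟨ rankGenCoeff-pairs EX maxX 1≤rX ⟨
  rankGenCoeff EX (rank EX) 2 + rankGenCoeff EX (rank EX ∸ 1) 1
    ≡⟨ cong₂ _+_ (same (rank EX) 2) (same (rank EX ∸ 1) 1) ⟩
  rankGenCoeff EY (rank EX) 2 + rankGenCoeff EY (rank EX ∸ 1) 1
    ≡⟨ cong (λ r → rankGenCoeff EY r 2 + rankGenCoeff EY (r ∸ 1) 1) rX≡rY ⟩
  rankGenCoeff EY (rank EY) 2 + rankGenCoeff EY (rank EY ∸ 1) 1
    ≡⟨ rankGenCoeff-pairs EY maxY (subst (1 ≤_) rX≡rY 1≤rX) ⟩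
  countPairs rankAtMost1 EY ∎
  where
  open ≡-Reasoning
  rX≡rY : rank EX ≡ rank EY
  rX≡rY = SameRankGen⇒rank≡ EX EY same

-- The new edge xy forms a pair of rank at most 1 exactly with the loops and the edges parallel to it.
countPairs-rankAtMost1-∷ʳ : ∀ {n} (E : List (Edge n)) (x y : Fin n) → ¬ x ≡ y →
  countPairs rankAtMost1 (E ++ (x , y) ∷ []) ≡ countPairs rankAtMost1 E + (count isLoop E + count (joins x y) E)
countPairs-rankAtMost1-∷ʳ E x y x≢y =
  trans (countPairs-∷ʳ rankAtMost1 E (x , y))
        (cong (countPairs rankAtMost1 E +_)
              (trans (count-cong E (rank-pair≤ᵇ1 x y x≢y)) (count-loops-or-joins x y x≢y E)))

SameRankGen⇒count-joins≡ : ∀ {m n} (EX : List (Edge m)) (EY : List (Edge n)) {x y : Fin m} {x′ y′ : Fin n} →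
  ¬ x ≡ y → ¬ x′ ≡ y′ → RankMaximal EX → RankMaximal EY →
  SameRankGen EX EY → SameRankGen (EX ++ (x , y) ∷ []) (EY ++ (x′ , y′) ∷ []) →
  count (joins x y) EX ≡ count (joins x′ y′) EY
SameRankGen⇒count-joins≡ EX EY {x} {y} {x′} {y′} x≢y x′≢y′ maxX maxY same same⁺ =
  ℕₚ.+-cancelˡ-≡ (countPairs rankAtMost1 EX + count isLoop EX) _ _ (begin
    countPairs rankAtMost1 EX + count isLoop EX + count (joins x y) EX
      ≡⟨ ℕₚ.+-assoc (countPairs rankAtMost1 EX) _ _ ⟩
    countPairs rankAtMost1 EX + (count isLoop EX + count (joins x y) EX)
      ≡⟨ countPairs-rankAtMost1-∷ʳ EX x y x≢y ⟨
    countPairs rankAtMost1 (EX ++ (x , y) ∷ [])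
      ≡⟨ SameRankGen⇒countPairs≡ (EX ++ (x , y) ∷ []) (EY ++ (x′ , y′) ∷ [])
           (RankMaximal-++ EX ((x , y) ∷ []) maxX) (RankMaximal-++ EY ((x′ , y′) ∷ []) maxY) same⁺
           (ℕₚ.≤-trans 1≤rX (rank-++ EX ((x , y) ∷ []))) ⟩
    countPairs rankAtMost1 (EY ++ (x′ , y′) ∷ [])
      ≡⟨ countPairs-rankAtMost1-∷ʳ EY x′ y′ x′≢y′ ⟩
    countPairs rankAtMost1 EY + (count isLoop EY + count (joins x′ y′) EY)
      ≡⟨ ℕₚ.+-assoc (countPairs rankAtMost1 EY) _ _ ⟨
    countPairs rankAtMost1 EY + count isLoop EY + count (joins x′ y′) EY
      ≡⟨ cong₂ (λ p l → p + l + count (joins x′ y′) EY)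
               (SameRankGen⇒countPairs≡ EX EY maxX maxY same 1≤rX)
               (SameRankGen⇒count-loops≡ EX EY maxX maxY same) ⟨
    countPairs rankAtMost1 EX + count isLoop EX + count (joins x′ y′) EY ∎)
  where
  open ≡-Reasoning
  1≤rX : 1 ≤ rank EX
  1≤rX = ℕₚ.≤-trans (rank-≥1 x y x≢y) (maxX ((x , y) ∷ []))

-- Adding the edges u_i u_j

concatMap-tabulate-[] : ∀ {X Y : Set} {k} (g : Fin k → Y) (f : Y → List X) → (∀ b → f (g b) ≡ []) →
  concatMap f (tabulate g) ≡ []
concatMap-tabulate-[] {k = zero}  g f empty = refl
concatMap-tabulate-[] {k = suc k} g f empty rewrite empty Fin.zero = concatMap-tabulate-[] (g ∘ Fin.suc) f (empty ∘ Fin.suc)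

concatMap-tabulate-single : ∀ {X Y : Set} {k} (g : Fin k → Y) (f : Y → List X) (j : Fin k) →
  (∀ b → ¬ b ≡ j → f (g b) ≡ []) → concatMap f (tabulate g) ≡ f (g j)
concatMap-tabulate-single g f Fin.zero empty =
  trans (cong (f (g Fin.zero) ++_) (concatMap-tabulate-[] (g ∘ Fin.suc) f (λ b → empty (Fin.suc b) (λ ()))))
        (++-identityʳ _)
concatMap-tabulate-single g f (Fin.suc j) empty rewrite empty Fin.zero (λ ()) =
  concatMap-tabulate-single (g ∘ Fin.suc) f j (λ b b≢j → empty (Fin.suc b) (b≢j ∘ Finₚ.suc-injective))

noPairs : ∀ {k} → PairSet k
noPairs _ _ = false

onlyPair : ∀ {k} → Fin k → Fin k → PairSet k
onlyPair i j a b = (a == i) ∧ (b == j)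

addEdges-noPairs : ∀ (G : Graph) {k} (u : Fin k → Fin (n G)) → edges (addEdges G u noPairs) ≡ edges G
addEdges-noPairs G {k} u =
  trans (cong (edges G ++_) (concatMap-tabulate-[] (λ a → a) _ (λ a → concatMap-tabulate-[] (λ b → b) _ (nothing a))))
        (++-identityʳ _)
  where
  nothing : ∀ a b → (if (a <ᵛ b) ∧ false then (u a , u b) ∷ [] else []) ≡ []
  nothing a b rewrite ∧-zeroʳ (a <ᵛ b) = refl

addEdges-onlyPair : ∀ (G : Graph) {k} (u : Fin k → Fin (n G)) {i j : Fin k} → i < j →
  edges (addEdges G u (onlyPair i j)) ≡ edges G ++ (u i , u j) ∷ []
addEdges-onlyPair G {k} u {i} {j} i<j =
  cong (edges G ++_) (trans (concatMap-tabulate-single (λ a → a) _ i other-rows) row-i)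
  where
  other-rows : ∀ a → ¬ a ≡ i →
    concatMap (λ b → if (a <ᵛ b) ∧ onlyPair i j a b then (u a , u b) ∷ [] else []) (allFin k) ≡ []
  other-rows a a≢i = concatMap-tabulate-[] (λ b → b) _ nothing
    where
    nothing : ∀ b → (if (a <ᵛ b) ∧ ((a == i) ∧ (b == j)) then (u a , u b) ∷ [] else []) ≡ []
    nothing b rewrite ≢⇒==-false a≢i | ∧-zeroʳ (a <ᵛ b) = refl
  row-i : concatMap (λ b → if (i <ᵛ b) ∧ onlyPair i j i b then (u i , u b) ∷ [] else []) (allFin k)
        ≡ (u i , u j) ∷ []
  row-i = trans (concatMap-tabulate-single (λ b → b) _ j nothing) entry-j
    where
    nothing : ∀ b → ¬ b ≡ j → (if (i <ᵛ b) ∧ ((i == i) ∧ (b == j)) then (u i , u b) ∷ [] else []) ≡ []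
    nothing b b≢j rewrite ≢⇒==-false b≢j | ∧-zeroʳ (i == i) | ∧-zeroʳ (i <ᵛ b) = refl
    entry-j : (if (i <ᵛ j) ∧ ((i == i) ∧ (j == j)) then (u i , u j) ∷ [] else []) ≡ (u i , u j) ∷ []
    entry-j rewrite ==-refl i | ==-refl j | <⇒<ᵛ {w = i} {v = j} i<j = refl

proposition3p2 : (G H : Graph) → Connected G → Connected H →
    (k : ℕ) (u : Fin k → Fin (n G)) (v : Fin k → Fin (n H)) →
    (∀ i j → u i ≡ u j → i ≡ j) → (∀ i j → v i ≡ v j → i ≡ j) →
    (∀ (S : PairSet k) → TEquivalent (addEdges G u S) (addEdges H v S)) →
    numLoops G ≡ numLoops H ×
    (∀ (i j : Fin k) → i < j → numJoining G (u i) (u j) ≡ numJoining H (v i) (v j))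
proposition3p2 G H G-connected H-connected k u v u-injective v-injective T≡ = same-loops , same-joins
  where
  maxG : RankMaximal (edges G)
  maxG = connected⇒RankMaximal G G-connected
  maxH : RankMaximal (edges H)
  maxH = connected⇒RankMaximal H H-connected
  same : ∀ S → SameRankGen (edges (addEdges G u S)) (edges (addEdges H v S))
  same S = TEquivalent⇒SameRankGen (addEdges G u S) (addEdges H v S) (T≡ S)
  same∅ : SameRankGen (edges G) (edges H)
  same∅ = subst₂ SameRankGen (addEdges-noPairs G u) (addEdges-noPairs H v) (same noPairs)
  same-loops : numLoops G ≡ numLoops H
  same-loops = SameRankGen⇒count-loops≡ (edges G) (edges H) maxG maxH same∅
  same-joins : ∀ i j → i < j → numJoining G (u i) (u j) ≡ numJoining H (v i) (v j)
  same-joins i j i<j =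
    SameRankGen⇒count-joins≡ (edges G) (edges H) (i≢j ∘ u-injective i j) (i≢j ∘ v-injective i j) maxG maxH same∅
      (subst₂ SameRankGen (addEdges-onlyPair G u i<j) (addEdges-onlyPair H v i<j) (same (onlyPair i j)))
    where
    i≢j : ¬ i ≡ j
    i≢j = Finₚ.<⇒≢ i<j
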